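{- Let $\mathcal{C}$ be a locally finite category having a finite dense subcategory, and let $U\colon \mathcal{C}\to\mathcal{C}$ be a categorical Gandy machine (as defined in the context). Let $\mathcal{G}$ be a dense subcategory of $\mathcal{C}$, and let $\iota\colon (\mathcal{G}\downarrow U)\hookrightarrow(\mathcal{C}\downarrow U)$ be the induced inclusion of comma categories. Then $U$ is the pointwise left Kan extension of $\mathrm{dom}\circ\iota\colon (\mathcal{G}\downarrow U)\to\mathcal{C}$ along $\mathrm{dom}\circ F^{\circ}\circ\iota\colon(\mathcal{G}\downarrow U)\to\mathcal{C}$, where $F^{\circ}$ is the left adjoint of $\widetilde{U}$.
   Context: Comma categories: for functors $F\colon\mathcal{X}\to\mathcal{C}$, $G\colon\mathcal{Y}\to\mathcal{C}$, the comma category $F\downarrow G$ has objects triples $(X,p,Y)$ with $X\in\mathcal{X}$, $Y\in\mathcal{Y}$, $p\colon FX\to GY$, and morphisms $(X,p,Y)\to(X',p',Y')$ pairs $(f,g)$ with $Gg\circ p=p'\circ Ff$. The functors $\mathrm{dom}\colon F\downarrow G\to\mathcal{X}$ and $\mathrm{cod}\colon F\downarrow G\to\mathcal{Y}$ are the projections to the first and third components, and the middle components form a natural transformation $\lambda\colon F\circ\mathrm{dom}\Rightarrow G\circ\mathrm{cod}$. For a subcategory $\mathcal{G}$ of $\mathcal{C}$, $\mathcal{G}$ in a comma category means its inclusion into $\mathcal{C}$; $\mathcal{C}$ means the identity functor; for an object $D$, $D$ means the constant functor from the one-object category. Thus objects of $\mathcal{C}\downarrow U$ are triples $(A,p,Y)$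 with $p\colon A\to UY$, and $\mathcal{G}\downarrow U$ is the full subcategory where $A\in\mathcal{G}$. Left Kan extension: given $F\colon\mathcal{X}\to\mathcal{D}$, $G\colon\mathcal{X}\to\mathcal{C}$, a left Kan extension of $G$ along $F$ is a functor $L\colon\mathcal{D}\to\mathcal{C}$ with a natural transformation $\kappa\colon G\Rightarrow L\circ F$ such that for every $K\colon\mathcal{D}\to\mathcal{C}$ and $\alpha\colon G\Rightarrow K\circ F$ there is a unique $\mu\colon L\Rightarrow K$ with $\alpha=(\mu F)\circ\kappa$. It is pointwise if for every functor $J\colon\mathcal{Y}\to\mathcal{D}$, the functor $L\circ J$ together with the pasted transformation $(\kappa\,\mathrm{dom})$ followed by $(L\lambda)$, i.e. $G\circ\mathrm{dom}\Rightarrow L\circ F\circ\mathrm{dom}\Rightarrow L\circ J\circ\mathrm{cod}$, is a left Kan extension of $G\circ\mathrm{dom}$ along $\mathrm{cod}$, where $\mathrm{dom},\mathrm{cod}$ are the projections of $F\downarrow J$. A functor "is the (pointwise) left Kan extension" means it admits such a natural transformation $\kappa$. A subcategory $\mathcal{G}$ of $\mathcal{C}$ is dense if the identity functor on $\mathcal{C}$ is the pointwise left Kan extension of the inclusion $\mathcal{G}\hookrightarrow\mathcal{C}$ along itself (equivalently, each object $X$ is canonically the colimit of the diagram $\mathcal{G}\downarrow X\to\mathcal{C}$). $\mathcal{C}$ is locally finite if all hom-sets are finite. For $U\colon\mathcal{C}\to\mathcal{C}$, the functor $\widetilde{U}\colon \mathcal{C}\downarrow\mathcal{C}\to\mathcal{C}\downarrow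 U$ sends an object $(X,f\colon X\to Y,Y)$ to $(UX,Uf,Y)$ and a morphism $(a,b)$ to $(Ua,b)$. A categorical Gandy machine is an endofunctor $U\colon\mathcal{C}\to\mathcal{C}$, where $\mathcal{C}$ is a locally finite category with a finite dense subcategory, such that (i) $\widetilde{U}$ has a left adjoint $F^{\circ}\colon\mathcal{C}\downarrow U\to\mathcal{C}\downarrow\mathcal{C}$, and (ii) for every subcategory $\mathcal{S}$ of $\mathcal{C}\downarrow U$ whose image $\mathrm{dom}[\mathcal{S}]$ under $\mathrm{dom}\colon\mathcal{C}\downarrow U\to\mathcal{C}$ is finite, the image $(\mathrm{dom}\circ F^{\circ})[\mathcal{S}]$ under $\mathrm{dom}\circ F^{\circ}$ (with $\mathrm{dom}\colon\mathcal{C}\downarrow\mathcal{C}\to\mathcal{C}$) is also finite. -}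

module Defs where

open import Level using (Level; _⊔_; suc; Setω)
open import Data.Product using (Σ; _×_; _,_; proj₁; proj₂)
open import Data.List using (List)
open import Data.List.Relation.Unary.Any using (Any)
open import Relation.Binary using (IsEquivalence; Setoid)
open import Relation.Binary.PropositionalEquality using (_≡_; subst₂)
import Relation.Binary.Reasoning.Setoid as SetoidR

record Category (o ℓ e : Level) : Set (suc (o ⊔ ℓ ⊔ e)) where
  infixr 9 _∘_
  infix 4 _≈_ _⇒_
  field
    Obj : Set o
    _⇒_ : Obj → Obj → Set ℓ
    _≈_ : ∀ {A B} → A ⇒ B → A ⇒ B → Set e
    id : ∀ {A} → A ⇒ A
    _∘_ : ∀ {A B C} → B ⇒ C → A ⇒ B → A ⇒ C
    equiv : ∀ {A B} → IsEquivalence (_≈_ {A} {B})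
    assoc : ∀ {A B C D} {f : A ⇒ B} {g : B ⇒ C} {h : C ⇒ D} →
            (h ∘ g) ∘ f ≈ h ∘ (g ∘ f)
    identityˡ : ∀ {A B} {f : A ⇒ B} → id ∘ f ≈ f
    identityʳ : ∀ {A B} {f : A ⇒ B} → f ∘ id ≈ f
    ∘-resp-≈ : ∀ {A B C} {f h : B ⇒ C} {g i : A ⇒ B} →
               f ≈ h → g ≈ i → f ∘ g ≈ h ∘ i

  hom-setoid : ∀ {A B} → Setoid ℓ e
  hom-setoid {A} {B} = record { Carrier = A ⇒ B ; _≈_ = _≈_ ; isEquivalence = equiv }

  module Eq {A B} = IsEquivalence (equiv {A} {B})
  module HomR {A B} = SetoidR (hom-setoid {A} {B})

  refl≈ : ∀ {A B} {f : A ⇒ B} → f ≈ f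
  refl≈ = IsEquivalence.refl equiv
  sym≈ : ∀ {A B} {f g : A ⇒ B} → f ≈ g → g ≈ f
  sym≈ = IsEquivalence.sym equiv
  trans≈ : ∀ {A B} {f g h : A ⇒ B} → f ≈ g → g ≈ h → f ≈ h
  trans≈ = IsEquivalence.trans equiv

  assoc⁻ : ∀ {A B C D} {f : A ⇒ B} {g : B ⇒ C} {h : C ⇒ D} →
           h ∘ (g ∘ f) ≈ (h ∘ g) ∘ f
  assoc⁻ = sym≈ assoc

record Functor {o ℓ e o′ ℓ′ e′ : Level}
               (C : Category o ℓ e) (D : Category o′ ℓ′ e′)
               : Set (o ⊔ ℓ ⊔ e ⊔ o′ ⊔ ℓ′ ⊔ e′) where
  private
    module C = Category C
    module D = Category D
  field
    F₀ : C.Obj → D.Obj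
    F₁ : ∀ {A B} → A C.⇒ B → F₀ A D.⇒ F₀ B
    identity : ∀ {A} → F₁ (C.id {A}) D.≈ D.id
    homomorphism : ∀ {A B C} {f : A C.⇒ B} {g : B C.⇒ C} →
                   F₁ (g C.∘ f) D.≈ F₁ g D.∘ F₁ f
    F-resp-≈ : ∀ {A B} {f g : A C.⇒ B} → f C.≈ g → F₁ f D.≈ F₁ g

idF : ∀ {o ℓ e} {C : Category o ℓ e} → Functor C C
idF {C = C} = record
  { F₀ = λ A → A
  ; F₁ = λ f → f
  ; identity = Category.refl≈ C
  ; homomorphism = Category.refl≈ C
  ; F-resp-≈ = λ p → p
  }

infixr 9 _∘F_
_∘F_ : ∀ {o₁ ℓ₁ e₁ o₂ ℓ₂ e₂ o₃ ℓ₃ e₃}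
         {A : Category o₁ ℓ₁ e₁} {B : Category o₂ ℓ₂ e₂} {C : Category o₃ ℓ₃ e₃} →
       Functor B C → Functor A B → Functor A C
_∘F_ {C = C} G F = record
  { F₀ = λ X → G.F₀ (F.F₀ X)
  ; F₁ = λ f → G.F₁ (F.F₁ f)
  ; identity = C.trans≈ (G.F-resp-≈ F.identity) G.identity
  ; homomorphism = C.trans≈ (G.F-resp-≈ F.homomorphism) G.homomorphism
  ; F-resp-≈ = λ p → G.F-resp-≈ (F.F-resp-≈ p)
  }
  where
    module C = Category C
    module F = Functor F
    module G = Functor G

record NatTrans {o ℓ e o′ ℓ′ e′ : Level}
                {C : Category o ℓ e} {D : Category o′ ℓ′ e′}
                (F G : Functor C D) : Set (o ⊔ ℓ ⊔ ℓ′ ⊔ e′) where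
  private
    module C = Category C
    module D = Category D
    module F = Functor F
    module G = Functor G
  field
    η : ∀ X → F.F₀ X D.⇒ G.F₀ X
    commute : ∀ {X Y} (f : X C.⇒ Y) → η Y D.∘ F.F₁ f D.≈ G.F₁ f D.∘ η X

module _ {o₁ ℓ₁ e₁ o₂ ℓ₂ e₂ o ℓ e : Level}
         {X : Category o₁ ℓ₁ e₁} {Y : Category o₂ ℓ₂ e₂} {C : Category o ℓ e}
         (F : Functor X C) (G : Functor Y C) where
  private
    module X = Category X
    module Y = Category Y
    module C = Category C
    module F = Functor F
    module G = Functor G

  record CommaObj : Set (o₁ ⊔ o₂ ⊔ ℓ) where
    field
      dom : X.Obj
      cod : Y.Obj
      arr : F.F₀ dom C.⇒ G.F₀ cod
  open CommaObj

  record CommaHom (a b : CommaObj) : Set (ℓ₁ ⊔ ℓ₂ ⊔ e) where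
    field
      f : dom a X.⇒ dom b
      g : cod a Y.⇒ cod b
      square : G.F₁ g C.∘ arr a C.≈ arr b C.∘ F.F₁ f
  open CommaHom

  Comma : Category (o₁ ⊔ o₂ ⊔ ℓ) (ℓ₁ ⊔ ℓ₂ ⊔ e) (e₁ ⊔ e₂)
  Comma = record
    { Obj = CommaObj
    ; _⇒_ = CommaHom
    ; _≈_ = λ h k → (f h X.≈ f k) × (g h Y.≈ g k)
    ; id = cid
    ; _∘_ = ccomp
    ; equiv = record
      { refl = X.refl≈ , Y.refl≈
      ; sym = λ (p , q) → X.sym≈ p , Y.sym≈ q
      ; trans = λ (p , q) (p′ , q′) → X.trans≈ p p′ , Y.trans≈ q q′
      }
    ; assoc = X.assoc , Y.assoc
    ; identityˡ = X.identityˡ , Y.identityˡ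
    ; identityʳ = X.identityʳ , Y.identityʳ
    ; ∘-resp-≈ = λ (p , q) (p′ , q′) → X.∘-resp-≈ p p′ , Y.∘-resp-≈ q q′
    }
    where
      cid : ∀ {a} → CommaHom a a
      cid {a} = record
        { f = X.id
        ; g = Y.id
        ; square = begin
            G.F₁ Y.id C.∘ arr a ≈⟨ C.∘-resp-≈ G.identity C.refl≈ ⟩
            C.id C.∘ arr a      ≈⟨ C.identityˡ ⟩
            arr a               ≈⟨ C.sym≈ C.identityʳ ⟩
            arr a C.∘ C.id      ≈⟨ C.∘-resp-≈ C.refl≈ (C.sym≈ F.identity) ⟩
            arr a C.∘ F.F₁ X.id ∎
        }
        where open C.HomR
      ccomp : ∀ {a b c} → CommaHom b c → CommaHom a b → CommaHom a c
      ccomp {a} {b} {c} k h = record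
        { f = f k X.∘ f h
        ; g = g k Y.∘ g h
        ; square = begin
            G.F₁ (g k Y.∘ g h) C.∘ arr a
              ≈⟨ C.∘-resp-≈ G.homomorphism C.refl≈ ⟩
            (G.F₁ (g k) C.∘ G.F₁ (g h)) C.∘ arr a
              ≈⟨ C.assoc ⟩
            G.F₁ (g k) C.∘ (G.F₁ (g h) C.∘ arr a)
              ≈⟨ C.∘-resp-≈ C.refl≈ (square h) ⟩
            G.F₁ (g k) C.∘ (arr b C.∘ F.F₁ (f h))
              ≈⟨ C.assoc⁻ ⟩
            (G.F₁ (g k) C.∘ arr b) C.∘ F.F₁ (f h)
              ≈⟨ C.∘-resp-≈ (square k) C.refl≈ ⟩
            (arr c C.∘ F.F₁ (f k)) C.∘ F.F₁ (f h)
              ≈⟨ C.assoc ⟩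
            arr c C.∘ (F.F₁ (f k) C.∘ F.F₁ (f h))
              ≈⟨ C.∘-resp-≈ C.refl≈ (C.sym≈ F.homomorphism) ⟩
            arr c C.∘ F.F₁ (f k X.∘ f h) ∎
        }
        where open C.HomR

  domF : Functor Comma X
  domF = record
    { F₀ = dom
    ; F₁ = f
    ; identity = X.refl≈
    ; homomorphism = X.refl≈
    ; F-resp-≈ = proj₁
    }

  codF : Functor Comma Y
  codF = record
    { F₀ = cod
    ; F₁ = g
    ; identity = Y.refl≈
    ; homomorphism = Y.refl≈
    ; F-resp-≈ = proj₂
    }

IsLan : ∀ {o₁ ℓ₁ e₁ o₂ ℓ₂ e₂ o ℓ e}
        {X : Category o₁ ℓ₁ e₁} {D : Category o₂ ℓ₂ e₂} {C : Category o ℓ e} →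
        (F : Functor X D) (G : Functor X C) (L : Functor D C) →
        NatTrans G (L ∘F F) → Set (o₁ ⊔ ℓ₁ ⊔ o₂ ⊔ ℓ₂ ⊔ e₂ ⊔ o ⊔ ℓ ⊔ e)
IsLan {D = D} {C = C} F G L κ =
  (K : Functor D C) (α : NatTrans G (K ∘F F)) →
  Σ (NatTrans L K) λ μ →
    (∀ x → NatTrans.η α x C.≈ NatTrans.η μ (Functor.F₀ F x) C.∘ NatTrans.η κ x)
    × ((μ′ : NatTrans L K) →
       (∀ x → NatTrans.η α x C.≈ NatTrans.η μ′ (Functor.F₀ F x) C.∘ NatTrans.η κ x) →
       ∀ d → NatTrans.η μ′ d C.≈ NatTrans.η μ d)
  where module C = Category C

module _ {o₁ ℓ₁ e₁ o₂ ℓ₂ e₂ o ℓ e : Level}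
         {X : Category o₁ ℓ₁ e₁} {D : Category o₂ ℓ₂ e₂} {C : Category o ℓ e} where
  private
    module C = Category C

  paste : ∀ {o₃ ℓ₃ e₃} {Y : Category o₃ ℓ₃ e₃}
          (F : Functor X D) (G : Functor X C) (L : Functor D C)
          (κ : NatTrans G (L ∘F F)) (J : Functor Y D) →
          NatTrans (G ∘F domF F J) ((L ∘F J) ∘F codF F J)
  paste F G L κ J = record
    { η = λ c → L.F₁ (CommaObj.arr c) C.∘ κ.η (CommaObj.dom c)
    ; commute = λ {a} {b} h →
        let open C.HomR in begin
          (L.F₁ (CommaObj.arr b) C.∘ κ.η (CommaObj.dom b)) C.∘ G.F₁ (CommaHom.f h)
            ≈⟨ C.assoc ⟩
          L.F₁ (CommaObj.arr b) C.∘ (κ.η (CommaObj.dom b) C.∘ G.F₁ (CommaHom.f h))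
            ≈⟨ C.∘-resp-≈ C.refl≈ (κ.commute (CommaHom.f h)) ⟩
          L.F₁ (CommaObj.arr b) C.∘ (L.F₁ (F.F₁ (CommaHom.f h)) C.∘ κ.η (CommaObj.dom a))
            ≈⟨ C.assoc⁻ ⟩
          (L.F₁ (CommaObj.arr b) C.∘ L.F₁ (F.F₁ (CommaHom.f h))) C.∘ κ.η (CommaObj.dom a)
            ≈⟨ C.∘-resp-≈ (C.sym≈ L.homomorphism) C.refl≈ ⟩
          L.F₁ (CommaObj.arr b D.∘ F.F₁ (CommaHom.f h)) C.∘ κ.η (CommaObj.dom a)
            ≈⟨ C.∘-resp-≈ (L.F-resp-≈ (D.sym≈ (CommaHom.square h))) C.refl≈ ⟩
          L.F₁ (J.F₁ (CommaHom.g h) D.∘ CommaObj.arr a) C.∘ κ.η (CommaObj.dom a)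
            ≈⟨ C.∘-resp-≈ L.homomorphism C.refl≈ ⟩
          (L.F₁ (J.F₁ (CommaHom.g h)) C.∘ L.F₁ (CommaObj.arr a)) C.∘ κ.η (CommaObj.dom a)
            ≈⟨ C.assoc ⟩
          L.F₁ (J.F₁ (CommaHom.g h)) C.∘ (L.F₁ (CommaObj.arr a) C.∘ κ.η (CommaObj.dom a)) ∎
    }
    where
      module D = Category D
      module F = Functor F
      module G = Functor G
      module L = Functor L
      module J = Functor J
      module κ = NatTrans κ

  IsPointwiseLan : (F : Functor X D) (G : Functor X C) (L : Functor D C) →
                   NatTrans G (L ∘F F) → Setω
  IsPointwiseLan F G L κ =
    ∀ {o₃ ℓ₃ e₃} {Y : Category o₃ ℓ₃ e₃} (J : Functor Y D) →
    IsLan (codF F J) (G ∘F domF F J) (L ∘F J) (paste F G L κ J)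

  record PointwiseLan (F : Functor X D) (G : Functor X C) (L : Functor D C) : Setω where
    field
      κ : NatTrans G (L ∘F F)
      pointwise : IsPointwiseLan F G L κ

record Subcategory {o ℓ e : Level} (C : Category o ℓ e) (p r : Level)
       : Set (o ⊔ ℓ ⊔ suc (p ⊔ r)) where
  open Category C
  field
    P : Obj → Set p
    R : ∀ {A B} → A ⇒ B → Set r
    R-dom : ∀ {A B} {f : A ⇒ B} → R f → P A
    R-cod : ∀ {A B} {f : A ⇒ B} → R f → P B
    R-id : ∀ {A} → P A → R (id {A})
    R-∘ : ∀ {A B C} {f : A ⇒ B} {g : B ⇒ C} → R f → R g → R (g ∘ f)

module _ {o ℓ e p r : Level} {C : Category o ℓ e} (S : Subcategory C p r) where
  private
    module C = Category C
    module S = Subcategory S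

  SubCat : Category (o ⊔ p) (ℓ ⊔ r) e
  SubCat = record
    { Obj = Σ C.Obj S.P
    ; _⇒_ = λ A B → Σ (proj₁ A C.⇒ proj₁ B) S.R
    ; _≈_ = λ f g → proj₁ f C.≈ proj₁ g
    ; id = λ {A} → C.id , S.R-id (proj₂ A)
    ; _∘_ = λ g f → (proj₁ g C.∘ proj₁ f) , S.R-∘ (proj₂ f) (proj₂ g)
    ; equiv = record { refl = C.refl≈ ; sym = C.sym≈ ; trans = C.trans≈ }
    ; assoc = C.assoc
    ; identityˡ = C.identityˡ
    ; identityʳ = C.identityʳ
    ; ∘-resp-≈ = C.∘-resp-≈
    }

  inclusion : Functor SubCat C
  inclusion = record
    { F₀ = proj₁
    ; F₁ = proj₁
    ; identity = C.refl≈
    ; homomorphism = C.refl≈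
    ; F-resp-≈ = λ q → q
    }

module _ {o ℓ e q : Level} (C : Category o ℓ e) (Q : Category.Obj C → Set q) where
  private
    module C = Category C

  FullSub : Category (o ⊔ q) ℓ e
  FullSub = record
    { Obj = Σ C.Obj Q
    ; _⇒_ = λ A B → proj₁ A C.⇒ proj₁ B
    ; _≈_ = C._≈_
    ; id = C.id
    ; _∘_ = C._∘_
    ; equiv = C.equiv
    ; assoc = C.assoc
    ; identityˡ = C.identityˡ
    ; identityʳ = C.identityʳ
    ; ∘-resp-≈ = C.∘-resp-≈
    }

  fullInclusion : Functor FullSub C
  fullInclusion = record
    { F₀ = proj₁
    ; F₁ = λ f → f
    ; identity = C.refl≈
    ; homomorphism = C.refl≈
    ; F-resp-≈ = λ q → q
    }

LocallyFinite : ∀ {o ℓ e} → Category o ℓ e → Set (o ⊔ ℓ ⊔ e)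
LocallyFinite C = ∀ A B → Σ (List (A ⇒ B)) λ L → ∀ (f : A ⇒ B) → Any (f ≈_) L
  where open Category C

-- The image H[S] of a subcategory S of A under a functor H : A → B is finite:
-- finitely many objects H X (X ∈ S, up to ≡) and finitely many morphisms
-- H f (f ∈ S, up to ≈).  (Since the objects are finite, finiteness of the
-- morphisms may be expressed hom-set by hom-set.)
ImageFinite : ∀ {o₁ ℓ₁ e₁ o₂ ℓ₂ e₂ p r}
              {A : Category o₁ ℓ₁ e₁} {B : Category o₂ ℓ₂ e₂} →
              Functor A B → Subcategory A p r → Set (o₁ ⊔ ℓ₁ ⊔ o₂ ⊔ ℓ₂ ⊔ e₂ ⊔ p ⊔ r)
ImageFinite {A = A} {B = B} H S =
  (Σ (List B.Obj) λ Ls → ∀ {X} → S.P X → Any (H.F₀ X ≡_) Ls)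
  × (∀ (A′ B′ : B.Obj) → Σ (List (A′ B.⇒ B′)) λ Ls →
       ∀ {X X′} (h : X A.⇒ X′) → S.R h →
       (eA : H.F₀ X ≡ A′) (eB : H.F₀ X′ ≡ B′) →
       Any (subst₂ B._⇒_ eA eB (H.F₁ h) B.≈_) Ls)
  where
    module A = Category A
    module B = Category B
    module H = Functor H
    module S = Subcategory S

FiniteSubcategory : ∀ {o ℓ e p r} {C : Category o ℓ e} → Subcategory C p r →
                    Set (o ⊔ ℓ ⊔ e ⊔ p ⊔ r)
FiniteSubcategory S = ImageFinite idF S

IsDense : ∀ {o ℓ e p r} {C : Category o ℓ e} → Subcategory C p r → Setω
IsDense S = PointwiseLan (inclusion S) (inclusion S) idF

record HasFiniteDenseSubcategory {o ℓ e} (C : Category o ℓ e) : Setω where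
  field
    p r : Level
    S : Subcategory C p r
    finite : FiniteSubcategory S
    dense : IsDense S

record Adjunction {o ℓ e o′ ℓ′ e′}
                  {C : Category o ℓ e} {D : Category o′ ℓ′ e′}
                  (L : Functor C D) (R : Functor D C)
                  : Set (o ⊔ ℓ ⊔ e ⊔ o′ ⊔ ℓ′ ⊔ e′) where
  private
    module C = Category C
    module D = Category D
    module L = Functor L
    module R = Functor R
  field
    unit : NatTrans idF (R ∘F L)
    counit : NatTrans (L ∘F R) idF
    zig : ∀ X → NatTrans.η counit (L.F₀ X) D.∘ L.F₁ (NatTrans.η unit X) D.≈ D.id
    zag : ∀ Y → R.F₁ (NatTrans.η counit Y) C.∘ NatTrans.η unit (R.F₀ Y) C.≈ C.id

module _ {o ℓ e} {C : Category o ℓ e} (U : Functor C C) where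
  private
    module C = Category C
    module U = Functor U

  C↓C : Category (o ⊔ ℓ) (ℓ ⊔ e) e
  C↓C = Comma (idF {C = C}) (idF {C = C})

  C↓U : Category (o ⊔ ℓ) (ℓ ⊔ e) e
  C↓U = Comma (idF {C = C}) U

  Ũ : Functor C↓C C↓U
  Ũ = record
    { F₀ = λ x → record { dom = U.F₀ (CommaObj.dom x)
                        ; cod = CommaObj.cod x
                        ; arr = U.F₁ (CommaObj.arr x) }
    ; F₁ = λ h → record
        { f = U.F₁ (CommaHom.f h)
        ; g = CommaHom.g h
        ; square = C.trans≈ (C.sym≈ U.homomorphism)
                     (C.trans≈ (U.F-resp-≈ (CommaHom.square h)) U.homomorphism)
        }
    ; identity = U.identity , C.refl≈
    ; homomorphism = U.homomorphism , C.refl≈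
    ; F-resp-≈ = λ (q , q′) → U.F-resp-≈ q , q′
    }

  _↓U : ∀ {p r} → Subcategory C p r → Category (o ⊔ ℓ ⊔ p) (ℓ ⊔ e) e
  G ↓U = FullSub C↓U (λ x → Subcategory.P G (CommaObj.dom x))

  ι : ∀ {p r} (G : Subcategory C p r) → Functor (G ↓U) C↓U
  ι G = fullInclusion C↓U (λ x → Subcategory.P G (CommaObj.dom x))

  domU : Functor C↓U C
  domU = domF (idF {C = C}) U

  domC : Functor C↓C C
  domC = domF (idF {C = C}) (idF {C = C})

  record GandyMachine : Setω where
    field
      locallyFinite : LocallyFinite C
      finiteDense : HasFiniteDenseSubcategory C
      F° : Functor C↓U C↓C
      adjunction : Adjunction F° Ũ
      boundedness : ∀ {p r} (S : Subcategory C↓U p r) →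
                    ImageFinite domU S → ImageFinite (domC ∘F F°) S

module Submission where

-- The unit of the adjunction F° ⊣ Ũ, read at an object x = (A , p , Y) of
-- G ↓ U, is a map κₓ : A → U (dom F° x); this is the Kan cell.  Fix J : Y → C.
-- Every object (A , p : A → U(J y) , y) of G ↓ (U ∘ J) gives a canonical object
-- of (dom ∘ F° ∘ ι) ↓ J, namely ((A , p , J y) , y , transpose of (p , id)),
-- on which the pasted cell is p itself.  Conversely, a transformation α out of
-- (dom ∘ F° ∘ ι) ↓ J is invariant along comma morphisms that are trivial on A
-- and on y, and a zigzag of three such morphisms connects every object
-- (x , y , q) to the canonical object of (A , U q ∘ κₓ , y).  Hence α is
-- determined by its values on canonical objects, i.e. by a transformation
-- out of G ↓ (U ∘ J); density of G (pointwise at U ∘ J) then provides the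
-- unique factorisation through U ∘ J, using that the density unit is split epi.

open import Data.Product using (Σ; _,_; proj₁; proj₂)
open import Defs

split-epi-cancel : ∀ {o ℓ e} (C : Category o ℓ e) → let open Category C in
  ∀ {A B D} {ε : A ⇒ B} {s : B ⇒ A} {u v : B ⇒ D} →
  ε ∘ s ≈ id → u ∘ ε ≈ v ∘ ε → u ≈ v
split-epi-cancel C {ε = ε} {s} {u} {v} section eq = begin
  u              ≈⟨ sym≈ identityʳ ⟩
  u ∘ id         ≈⟨ ∘-resp-≈ refl≈ (sym≈ section) ⟩
  u ∘ (ε ∘ s)    ≈⟨ assoc⁻ ⟩
  (u ∘ ε) ∘ s    ≈⟨ ∘-resp-≈ eq refl≈ ⟩
  (v ∘ ε) ∘ s    ≈⟨ assoc ⟩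
  v ∘ (ε ∘ s)    ≈⟨ ∘-resp-≈ refl≈ section ⟩
  v ∘ id         ≈⟨ identityʳ ⟩
  v              ∎
  where open Category C
        open HomR

module Transpose {o ℓ e o′ ℓ′ e′} {C : Category o ℓ e} {D : Category o′ ℓ′ e′}
                 {L : Functor C D} {R : Functor D C} (adj : Adjunction L R) where
  private
    module C = Category C
    module D = Category D
    module L = Functor L
    module R = Functor R
    module η = NatTrans (Adjunction.unit adj)
    module ε = NatTrans (Adjunction.counit adj)

  transpose : ∀ {x z} → x C.⇒ R.F₀ z → L.F₀ x D.⇒ z
  transpose {z = z} m = ε.η z D.∘ L.F₁ m

  transpose-resp-≈ : ∀ {x z} {m m′ : x C.⇒ R.F₀ z} → m C.≈ m′ →
                     transpose m D.≈ transpose m′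
  transpose-resp-≈ eq = D.∘-resp-≈ D.refl≈ (L.F-resp-≈ eq)

  transpose-natˡ : ∀ {x z z′} (k : z D.⇒ z′) (m : x C.⇒ R.F₀ z) →
                   transpose (R.F₁ k C.∘ m) D.≈ k D.∘ transpose m
  transpose-natˡ {z = z} {z′} k m = begin
    ε.η z′ D.∘ L.F₁ (R.F₁ k C.∘ m)          ≈⟨ D.∘-resp-≈ D.refl≈ L.homomorphism ⟩
    ε.η z′ D.∘ (L.F₁ (R.F₁ k) D.∘ L.F₁ m)   ≈⟨ D.assoc⁻ ⟩
    (ε.η z′ D.∘ L.F₁ (R.F₁ k)) D.∘ L.F₁ m   ≈⟨ D.∘-resp-≈ (ε.commute k) D.refl≈ ⟩
    (k D.∘ ε.η z) D.∘ L.F₁ m                ≈⟨ D.assoc ⟩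
    k D.∘ transpose m                       ∎
    where open D.HomR

  transpose-natʳ : ∀ {x x′ z} (m : x′ C.⇒ R.F₀ z) (h : x C.⇒ x′) →
                   transpose (m C.∘ h) D.≈ transpose m D.∘ L.F₁ h
  transpose-natʳ m h = D.trans≈ (D.∘-resp-≈ D.refl≈ L.homomorphism) D.assoc⁻

  transpose-square : ∀ {x x′ z z′} (m : x′ C.⇒ R.F₀ z′) (h : x C.⇒ x′)
                     (k : z D.⇒ z′) (m₀ : x C.⇒ R.F₀ z) →
                     m C.∘ h C.≈ R.F₁ k C.∘ m₀ →
                     transpose m D.∘ L.F₁ h D.≈ k D.∘ transpose m₀
  transpose-square m h k m₀ eq =
    D.trans≈ (D.sym≈ (transpose-natʳ m h))
      (D.trans≈ (transpose-resp-≈ eq) (transpose-natˡ k m₀))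

  transpose-unit : ∀ x → transpose (η.η x) D.≈ D.id
  transpose-unit = Adjunction.zig adj

  untranspose : ∀ {x z} (m : x C.⇒ R.F₀ z) → R.F₁ (transpose m) C.∘ η.η x C.≈ m
  untranspose {x} {z} m = begin
    R.F₁ (ε.η z D.∘ L.F₁ m) C.∘ η.η x               ≈⟨ C.∘-resp-≈ R.homomorphism C.refl≈ ⟩
    (R.F₁ (ε.η z) C.∘ R.F₁ (L.F₁ m)) C.∘ η.η x      ≈⟨ C.assoc ⟩
    R.F₁ (ε.η z) C.∘ (R.F₁ (L.F₁ m) C.∘ η.η x)      ≈⟨ C.∘-resp-≈ C.refl≈ (C.sym≈ (η.commute m)) ⟩
    R.F₁ (ε.η z) C.∘ (η.η (R.F₀ z) C.∘ m)           ≈⟨ C.assoc⁻ ⟩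
    (R.F₁ (ε.η z) C.∘ η.η (R.F₀ z)) C.∘ m           ≈⟨ C.∘-resp-≈ (Adjunction.zag adj z) C.refl≈ ⟩
    C.id C.∘ m                                      ≈⟨ C.identityˡ ⟩
    m                                               ∎
    where open C.HomR

-- The unit  a → a  of a dense subcategory is split epi: the Kan property
-- along J = id, applied to the tautological cell (a , p , X) ↦ p, yields a
-- retraction ρ of it, and naturality of ρ turns it into a section.
dense-unit-section : ∀ {o ℓ e p r} {C : Category o ℓ e} (G : Subcategory C p r)
  (dense : IsDense G) (a : Σ (Category.Obj C) (Subcategory.P G)) →
  Σ (Category._⇒_ C (proj₁ a) (proj₁ a)) λ s →
    Category._≈_ C (Category._∘_ C (NatTrans.η (PointwiseLan.κ dense) a) s) (Category.id C)
dense-unit-section {C = C} G dense a = ρ.η (proj₁ a) , section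
  where
    open Category C
    open CommaObj
    module κ = NatTrans (PointwiseLan.κ dense)

    tautological : NatTrans (inclusion G ∘F domF (inclusion G) idF) (idF ∘F codF (inclusion G) idF)
    tautological = record { η = arr ; commute = λ h → sym≈ (CommaHom.square h) }

    ρ : NatTrans (idF ∘F idF) idF
    ρ = proj₁ (PointwiseLan.pointwise dense idF idF tautological)
    module ρ = NatTrans ρ

    ρ-factors : ∀ c → arr c ≈ ρ.η (cod c) ∘ (arr c ∘ κ.η (dom c))
    ρ-factors = proj₁ (proj₂ (PointwiseLan.pointwise dense idF idF tautological))

    retraction : ρ.η (proj₁ a) ∘ κ.η a ≈ id
    retraction = sym≈ (trans≈ (ρ-factors identityAt) (∘-resp-≈ refl≈ identityˡ))
      where identityAt : CommaObj (inclusion G) idF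
            identityAt = record { dom = a ; cod = proj₁ a ; arr = id }

    section : κ.η a ∘ ρ.η (proj₁ a) ≈ id
    section = trans≈ (sym≈ (ρ.commute (κ.η a))) retraction

module CommaInvariance {o₁ ℓ₁ e₁ o₂ ℓ₂ e₂ o ℓ e o′ ℓ′ e′}
  {X : Category o₁ ℓ₁ e₁} {Y : Category o₂ ℓ₂ e₂}
  {D : Category o ℓ e} {C : Category o′ ℓ′ e′}
  {F : Functor X D} {J : Functor Y D} {G : Functor X C} {K : Functor Y C}
  (α : NatTrans (G ∘F domF F J) (K ∘F codF F J)) where
  private
    module X = Category X
    module Y = Category Y
    module D = Category D
    module C = Category C
    module F = Functor F
    module J = Functor J
    module G = Functor G
    module K = Functor K
    module α = NatTrans α

  object : (x : X.Obj) (y : Y.Obj) → F.F₀ x D.⇒ J.F₀ y → CommaObj F J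
  object x y r = record { dom = x ; cod = y ; arr = r }

  vertical : ∀ {x x′ y} {r : F.F₀ x D.⇒ J.F₀ y} {r′ : F.F₀ x′ D.⇒ J.F₀ y}
             (h : x X.⇒ x′) → r D.≈ r′ D.∘ F.F₁ h →
             α.η (object x y r) C.≈ α.η (object x′ y r′) C.∘ G.F₁ h
  vertical {x} {x′} {y} {r} {r′} h commutes = begin
    α.η (object x y r)                       ≈⟨ C.sym≈ C.identityˡ ⟩
    C.id C.∘ α.η (object x y r)              ≈⟨ C.∘-resp-≈ (C.sym≈ K.identity) C.refl≈ ⟩
    K.F₁ Y.id C.∘ α.η (object x y r)         ≈⟨ C.sym≈ (α.commute verticalHom) ⟩
    α.η (object x′ y r′) C.∘ G.F₁ h          ∎
    where
      open C.HomR
      verticalHom : CommaHom F J (object x y r) (object x′ y r′)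
      verticalHom = record { f = h ; g = Y.id
                           ; square = D.trans≈ (D.∘-resp-≈ J.identity D.refl≈)
                                               (D.trans≈ D.identityˡ commutes) }

  resp-arr : ∀ {x y} {r r′ : F.F₀ x D.⇒ J.F₀ y} → r D.≈ r′ →
             α.η (object x y r) C.≈ α.η (object x y r′)
  resp-arr eq =
    C.trans≈ (vertical X.id (D.trans≈ eq (D.trans≈ (D.sym≈ D.identityʳ) (D.∘-resp-≈ D.refl≈ (D.sym≈ F.identity)))))
      (C.trans≈ (C.∘-resp-≈ C.refl≈ G.identity) C.identityʳ)

  restrict : ∀ {x x′ y} (h : x X.⇒ x′) (q : F.F₀ x′ D.⇒ J.F₀ y) →
             α.η (object x y (q D.∘ F.F₁ h)) C.≈ α.η (object x′ y q) C.∘ G.F₁ h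
  restrict h q = vertical h D.refl≈

module GandyKan {o ℓ e} {C : Category o ℓ e} {U : Functor C C} (M : GandyMachine U)
                {p r} (G : Subcategory C p r) (dense : IsDense G) where
  open Category C
  open CommaObj
  open CommaHom
  private
    module U = Functor U
    module CU = Category (C↓U U)
    module CC = Category (C↓C U)
    module Ũ = Functor (Ũ U)
    F° : Functor (C↓U U) (C↓C U)
    F° = GandyMachine.F° M
    module F° = Functor F°
    adjunction : Adjunction F° (Ũ U)
    adjunction = GandyMachine.adjunction M
    module unit = NatTrans (Adjunction.unit adjunction)
    module Dense = PointwiseLan dense
    module κG = NatTrans Dense.κ
    open Transpose adjunction

  Along Extended : Functor (_↓U U G) C
  Along = domC U ∘F (F° ∘F ι U G)
  Extended = domU U ∘F ι U G

  κ : NatTrans Extended (U ∘F Along)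
  κ = record { η = λ x → f (unit.η (proj₁ x)) ; commute = λ h → proj₁ (unit.commute h) }

  module Pointwise {o₃ ℓ₃ e₃} {Y : Category o₃ ℓ₃ e₃} (J : Functor Y C) where
    private
      module Y = Category Y
      module J = Functor J
    UJ : Functor Y C
    UJ = U ∘F J

    pasted : NatTrans (Extended ∘F domF Along J) (UJ ∘F codF Along J)
    pasted = paste Along Extended U κ J

    identityOn : Y.Obj → CC.Obj
    identityOn y = record { dom = J.F₀ y ; cod = J.F₀ y ; arr = id }

    asU : CommaObj (inclusion G) UJ → CU.Obj
    asU c = record { dom = proj₁ (dom c) ; cod = J.F₀ (cod c) ; arr = arr c }

    toIdentity : ∀ c → asU c CU.⇒ Ũ.F₀ (identityOn (cod c))
    toIdentity c = record { f = arr c ; g = id ; square = refl≈ }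

    canonical : CommaObj (inclusion G) UJ → CommaObj Along J
    canonical c = record { dom = asU c , proj₂ (dom c) ; cod = cod c
                         ; arr = f (transpose (toIdentity c)) }

    canonical₁ : ∀ {c c′} → CommaHom (inclusion G) UJ c c′ →
                 CommaHom Along J (canonical c) (canonical c′)
    canonical₁ {c} {c′} h = record { f = onU ; g = g h ; square = sym≈ (proj₁ transposed) }
      where
        onU : asU c CU.⇒ asU c′
        onU = record { f = proj₁ (f h) ; g = J.F₁ (g h) ; square = square h }
        onIdentity : identityOn (cod c) CC.⇒ identityOn (cod c′)
        onIdentity = record { f = J.F₁ (g h) ; g = J.F₁ (g h)
                            ; square = trans≈ identityʳ (sym≈ identityˡ) }
        transposed : transpose (toIdentity c′) CC.∘ F°.F₁ onU CC.≈ onIdentity CC.∘ transpose (toIdentity c)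
        transposed = transpose-square (toIdentity c′) onU onIdentity (toIdentity c)
                       (sym≈ (square h) , trans≈ identityˡ (sym≈ identityʳ))

    paste-canonical : ∀ c → NatTrans.η pasted (canonical c) ≈ arr c
    paste-canonical c = proj₁ (untranspose (toIdentity c))

    reduce : CommaObj Along J → CommaObj (inclusion G) UJ
    reduce c = record { dom = CommaObj.dom (proj₁ (dom c)) , proj₂ (dom c) ; cod = cod c
                      ; arr = NatTrans.η pasted c }

    -- The zigzag connecting an object c = (x , y , q) of (dom ∘ F° ∘ ι) ↓ J to
    -- canonical (reduce c): with F° x = (X′ , f′ , Y′), the objects
    -- x₁ = (A , U f′ ∘ κₓ , Y′) and x₂ = (A , κₓ , X′) of G ↓ U and the
    -- morphisms  x →h₁ x₁ ←h₂ x₂ →h₃ (A , U q ∘ κₓ , J y),  all with identity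
    -- A-component.  The arrows over x₁, x₂, x₃ are transposes of the maps
    -- n₁ , n₂ , m₃ into Ũ, with w = (X′ , id , X′); through₁/₂ are the arrow
    -- equations that make h₁ , h₂ , h₃ comma morphisms.
    module Zigzag (c : CommaObj Along J) where
      open HomR

      x : CU.Obj
      x = proj₁ (dom c)
      P : Subcategory.P G (dom x)
      P = proj₂ (dom c)
      y : Y.Obj
      y = cod c
      q : dom (F°.F₀ x) ⇒ J.F₀ y
      q = arr c
      κₓ : dom x ⇒ U.F₀ (dom (F°.F₀ x))
      κₓ = f (unit.η x)
      F°x : CC.Obj
      F°x = F°.F₀ x
      x₁ x₂ : CU.Obj
      x₁ = record { dom = dom x ; cod = cod F°x ; arr = U.F₁ (arr F°x) ∘ κₓ }
      x₂ = record { dom = dom x ; cod = dom F°x ; arr = κₓ }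
      w : CC.Obj
      w = record { dom = dom F°x ; cod = dom F°x ; arr = id }
      x₃ : CU.Obj
      x₃ = asU (reduce c)
      m₃ : x₃ CU.⇒ Ũ.F₀ (identityOn y)
      m₃ = toIdentity (reduce c)
      n₁ : x₁ CU.⇒ Ũ.F₀ F°x
      n₁ = record { f = κₓ ; g = id ; square = trans≈ (∘-resp-≈ U.identity refl≈) identityˡ }
      n₂ : x₂ CU.⇒ Ũ.F₀ w
      n₂ = record { f = κₓ ; g = id ; square = refl≈ }
      h₁ : x CU.⇒ x₁
      h₁ = record { f = id ; g = g (unit.η x) ; square = trans≈ (square (unit.η x)) (sym≈ identityʳ) }
      h₂ : x₂ CU.⇒ x₁
      h₂ = record { f = id ; g = arr F°x ; square = sym≈ identityʳ }
      h₃ : x₂ CU.⇒ x₃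
      h₃ = record { f = id ; g = q ; square = sym≈ identityʳ }
      k₂ : w CC.⇒ F°x
      k₂ = record { f = id ; g = arr F°x ; square = refl≈ }
      k₃ : w CC.⇒ identityOn y
      k₃ = record { f = q ; g = q ; square = trans≈ identityʳ (sym≈ identityˡ) }

      -- n₁ ∘ h₁ is the unit, whose transpose is the identity
      through₁ : q ≈ (q ∘ f (transpose n₁)) ∘ f (F°.F₁ h₁)
      through₁ = begin
        q                                          ≈⟨ sym≈ identityʳ ⟩
        q ∘ id                                     ≈⟨ ∘-resp-≈ refl≈ (sym≈ (proj₁ (transpose-unit x))) ⟩
        q ∘ f (transpose (unit.η x))               ≈⟨ ∘-resp-≈ refl≈ (sym≈ (proj₁ (transpose-resp-≈ {m = n₁ CU.∘ h₁} (identityʳ , identityˡ)))) ⟩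
        q ∘ f (transpose (n₁ CU.∘ h₁))             ≈⟨ ∘-resp-≈ refl≈ (proj₁ (transpose-natʳ n₁ h₁)) ⟩
        q ∘ (f (transpose n₁) ∘ f (F°.F₁ h₁))      ≈⟨ assoc⁻ ⟩
        (q ∘ f (transpose n₁)) ∘ f (F°.F₁ h₁)      ∎

      -- both sides factor through the transpose of n₂
      through₂ : (q ∘ f (transpose n₁)) ∘ f (F°.F₁ h₂) ≈ f (transpose m₃) ∘ f (F°.F₁ h₃)
      through₂ = begin
        (q ∘ f (transpose n₁)) ∘ f (F°.F₁ h₂)      ≈⟨ assoc ⟩
        q ∘ (f (transpose n₁) ∘ f (F°.F₁ h₂))      ≈⟨ ∘-resp-≈ refl≈ (proj₁ (transpose-square n₁ h₂ k₂ n₂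
                                                        (trans≈ identityʳ (sym≈ (trans≈ (∘-resp-≈ U.identity refl≈) identityˡ))
                                                        , trans≈ identityˡ (sym≈ identityʳ)))) ⟩
        q ∘ (id ∘ f (transpose n₂))                ≈⟨ ∘-resp-≈ refl≈ identityˡ ⟩
        q ∘ f (transpose n₂)                       ≈⟨ sym≈ (proj₁ (transpose-square m₃ h₃ k₃ n₂
                                                        (identityʳ , trans≈ identityˡ (sym≈ identityʳ)))) ⟩
        f (transpose m₃) ∘ f (F°.F₁ h₃)            ∎

    module Factor {K : Functor Y C}
                  (α : NatTrans (Extended ∘F domF Along J) (K ∘F codF Along J)) where
      private
        module K = Functor K
        module α = NatTrans α
      open CommaInvariance α

      α-reduce : ∀ c → α.η c ≈ α.η (canonical (reduce c))
      α-reduce c = begin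
          α.η c                                               ≈⟨ resp-arr through₁ ⟩
          α.η (object (x , P) y ((q ∘ f (transpose n₁)) ∘ f (F°.F₁ h₁)))
                                                              ≈⟨ trans≈ (restrict h₁ _) identityʳ ⟩
          α.η (object (x₁ , P) y (q ∘ f (transpose n₁)))      ≈⟨ sym≈ (trans≈ (restrict h₂ _) identityʳ) ⟩
          α.η (object (x₂ , P) y ((q ∘ f (transpose n₁)) ∘ f (F°.F₁ h₂)))
                                                              ≈⟨ resp-arr through₂ ⟩
          α.η (object (x₂ , P) y (f (transpose m₃) ∘ f (F°.F₁ h₃)))
                                                              ≈⟨ trans≈ (restrict h₃ _) identityʳ ⟩
          α.η (canonical (reduce c))                          ∎
        where
          open HomR
          open Zigzag c using (x; P; y; q; x₁; x₂; m₃; n₁; h₁; h₂; h₃; through₁; through₂)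

      β : NatTrans (inclusion G ∘F domF (inclusion G) UJ) (K ∘F codF (inclusion G) UJ)
      β = record
        { η = λ c → α.η (canonical c) ∘ κG.η (dom c)
        ; commute = λ {c} {c′} h → begin
            (α.η (canonical c′) ∘ κG.η (dom c′)) ∘ proj₁ (f h)   ≈⟨ assoc ⟩
            α.η (canonical c′) ∘ (κG.η (dom c′) ∘ proj₁ (f h))   ≈⟨ ∘-resp-≈ refl≈ (κG.commute (f h)) ⟩
            α.η (canonical c′) ∘ (proj₁ (f h) ∘ κG.η (dom c))    ≈⟨ assoc⁻ ⟩
            (α.η (canonical c′) ∘ proj₁ (f h)) ∘ κG.η (dom c)    ≈⟨ ∘-resp-≈ (α.commute (canonical₁ h)) refl≈ ⟩
            (K.F₁ (g h) ∘ α.η (canonical c)) ∘ κG.η (dom c)      ≈⟨ assoc ⟩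
            K.F₁ (g h) ∘ (α.η (canonical c) ∘ κG.η (dom c))      ∎
        }
        where open HomR

      ν₀ : NatTrans (idF ∘F UJ) K
      ν₀ = proj₁ (Dense.pointwise UJ K β)
      module ν = NatTrans ν₀

      β-factors-ν : ∀ c → NatTrans.η β c ≈ ν.η (cod c) ∘ (arr c ∘ κG.η (dom c))
      β-factors-ν = proj₁ (proj₂ (Dense.pointwise UJ K β))

      β-factors-uniquely : (μ : NatTrans (idF ∘F UJ) K) →
        (∀ c → NatTrans.η β c ≈ NatTrans.η μ (cod c) ∘ (arr c ∘ κG.η (dom c))) →
        ∀ d → NatTrans.η μ d ≈ ν.η d
      β-factors-uniquely = proj₂ (proj₂ (Dense.pointwise UJ K β))

      ν : NatTrans UJ K
      ν = record { η = ν.η ; commute = ν.commute }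

      -- on canonical objects α is ν; the unit is cancelled by its section
      α-canonical : ∀ c → α.η (canonical c) ≈ ν.η (cod c) ∘ arr c
      α-canonical c = split-epi-cancel C (proj₂ (dense-unit-section G dense (dom c)))
        (trans≈ (β-factors-ν c) assoc⁻)

      factors : ∀ c → α.η c ≈ ν.η (cod c) ∘ NatTrans.η pasted c
      factors c = trans≈ (α-reduce c) (α-canonical (reduce c))

      unique : (μ : NatTrans UJ K) →
               (∀ c → α.η c ≈ NatTrans.η μ (cod c) ∘ NatTrans.η pasted c) →
               ∀ d → NatTrans.η μ d ≈ ν.η d
      unique μ μ-factors = β-factors-uniquely μ′ β-factors
        where
          module μ = NatTrans μ
          μ′ : NatTrans (idF ∘F UJ) K
          μ′ = record { η = μ.η ; commute = μ.commute }
          β-factors : ∀ c → NatTrans.η β c ≈ μ.η (cod c) ∘ (arr c ∘ κG.η (dom c))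
          β-factors c = begin
            α.η (canonical c) ∘ κG.η (dom c)                                       ≈⟨ ∘-resp-≈ (μ-factors (canonical c)) refl≈ ⟩
            (μ.η (cod c) ∘ NatTrans.η pasted (canonical c)) ∘ κG.η (dom c)
                                                                                   ≈⟨ ∘-resp-≈ (∘-resp-≈ refl≈ (paste-canonical c)) refl≈ ⟩
            (μ.η (cod c) ∘ arr c) ∘ κG.η (dom c)                                   ≈⟨ assoc ⟩
            μ.η (cod c) ∘ (arr c ∘ κG.η (dom c))                                   ∎
            where open HomR

    isLan : IsLan (codF Along J) (Extended ∘F domF Along J) UJ pasted
    isLan K α = ν , factors , unique
      where open Factor {K = K} α

proposition1 : ∀ {o ℓ e} (C : Category o ℓ e) →
    LocallyFinite C →
    HasFiniteDenseSubcategory C →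
    (U : Functor C C) (M : GandyMachine U) →
    ∀ {p r} (G : Subcategory C p r) → IsDense G →
    PointwiseLan
    (domC U ∘F (GandyMachine.F° M ∘F ι U G))
    (domU U ∘F ι U G)
    U
proposition1 C _ _ U M G dense = record
  { κ = GandyKan.κ M G dense
  ; pointwise = λ J → GandyKan.Pointwise.isLan M G dense J }
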